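{- Let $r\geq 2$ be an integer, let $G$ be a triangle-free $4$-sunspot-free graph, and let $(L_0,\ldots,L_r)$ be an $r$-leveling in $G$. Let $H$ be a hole of length at least $6$ in $G[L_r]$ and let $x\in L_{r-1}$. Then there is no $x$-sector of length at most $2$ in $H$.
   Context: Graphs are finite and simple. A $4$-sunspot in $G$ is a $7$-tuple $(x_1,x_2,x_3,x_4;y_1,y_2,y_3)$ of pairwise distinct vertices such that the edges of $G$ among them are exactly $x_1x_2,x_2x_3,x_3x_4,x_4x_1,x_1y_1,x_2y_2,x_3y_3$; $G$ is $4$-sunspot-free if none exists. An $r$-leveling in $G$ is a tuple $(L_0,\ldots,L_r)$ of pairwise disjoint nonempty vertex subsets such that every vertex of $L_i$ ($1\le i\le r$) has a neighbor in $L_{i-1}$, and any edge between $L_i$ and $L_j$ with $i\neq j$ has $|i-j|=1$. A hole is an induced cycle on at least four vertices, its length being its number of edges. A path in $G$ is an induced subgraph that is a path; its length is its number of edges, its interior is the set of non-end vertices. For a hole $H$ and a vertex $x\notin H$, an $x$-sector in $H$ is a path of nonzero length in $H$ whose two ends are adjacent to $x$ and whose interior vertices are all non-adjacent to $x$. -}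

module Defs where

open import Data.Nat using (ℕ; zero; suc; _≤_)
open import Data.Fin using (Fin; toℕ; inject₁)
open import Data.Fin.Subset using (Subset; _∈_)
open import Data.Bool using (Bool; true; false; T; _∨_)
open import Data.Product using (Σ; ∃; _×_; _,_)
open import Data.Sum using (_⊎_)
open import Data.Empty using (⊥)
open import Relation.Nullary using (¬_; Dec)
open import Relation.Binary.PropositionalEquality using (_≡_; _≢_)
open import Function.Bundles using (_⇔_)

record Graph : Set₁ where
  field
    n      : ℕ
    Adj    : Fin n → Fin n → Set
    sym    : ∀ {u v} → Adj u v → Adj v u
    irrefl : ∀ v → ¬ Adj v v
    dec    : ∀ u v → Dec (Adj u v)

open Graph public

Vertex : Graph → Set
Vertex G = Fin (n G)

Distinct : ∀ {G : Graph} {m : ℕ} → (Fin m → Vertex G) → Set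
Distinct {m = m} f = ∀ (i j : Fin m) → f i ≡ f j → i ≡ j

TriangleFree : Graph → Set
TriangleFree G = ∀ (a b c : Vertex G) → Adj G a b → Adj G b c → Adj G a c → ⊥

-- 4-sunspot pattern on indices 0..6 = x1,x2,x3,x4,y1,y2,y3
sunBase : Fin 7 → Fin 7 → Bool
sunBase Fin.zero (Fin.suc Fin.zero) = true
sunBase (Fin.suc Fin.zero) (Fin.suc (Fin.suc Fin.zero)) = true
sunBase (Fin.suc (Fin.suc Fin.zero)) (Fin.suc (Fin.suc (Fin.suc Fin.zero))) = true
sunBase (Fin.suc (Fin.suc (Fin.suc Fin.zero))) Fin.zero = true
sunBase Fin.zero (Fin.suc (Fin.suc (Fin.suc (Fin.suc Fin.zero)))) = true
sunBase (Fin.suc Fin.zero) (Fin.suc (Fin.suc (Fin.suc (Fin.suc (Fin.suc Fin.zero))))) = true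
sunBase (Fin.suc (Fin.suc Fin.zero)) (Fin.suc (Fin.suc (Fin.suc (Fin.suc (Fin.suc (Fin.suc Fin.zero)))))) = true
sunBase _ _ = false

sunEdge : Fin 7 → Fin 7 → Bool
sunEdge a b = sunBase a b ∨ sunBase b a

Sunspot4 : (G : Graph) → Set
Sunspot4 G = Σ (Fin 7 → Vertex G) λ s →
  Distinct {G} s × (∀ a b → Adj G (s a) (s b) ⇔ T (sunEdge a b))

SunspotFree4 : Graph → Set
SunspotFree4 G = ¬ Sunspot4 G

record Leveling (G : Graph) (r : ℕ) : Set where
  field
    L         : Fin (suc r) → Subset (n G)
    disjoint  : ∀ i j → i ≢ j → ∀ v → v ∈ L i → v ∈ L j → ⊥
    nonempty  : ∀ i → ∃ λ v → v ∈ L i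
    down      : ∀ (i : Fin r) v → v ∈ L (Fin.suc i) →
                ∃ λ u → u ∈ L (inject₁ i) × Adj G v u
    edges     : ∀ i j → i ≢ j → ∀ u v → u ∈ L i → v ∈ L j → Adj G u v →
                (toℕ i ≡ suc (toℕ j)) ⊎ (toℕ j ≡ suc (toℕ i))

open Leveling public

CycAdj : (k : ℕ) → Fin k → Fin k → Set
CycAdj k i j = (toℕ i ≡ suc (toℕ j)) ⊎ (toℕ j ≡ suc (toℕ i))
             ⊎ ((toℕ i ≡ 0) × (suc (toℕ j) ≡ k))
             ⊎ ((toℕ j ≡ 0) × (suc (toℕ i) ≡ k))

record Hole (G : Graph) (k : ℕ) : Set where
  field
    h        : Fin k → Vertex G
    long     : 4 ≤ k
    distinct : Distinct {G} h
    induced  : ∀ i j → Adj G (h i) (h j) ⇔ CycAdj k i j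

open Hole public

PathAdj : (m : ℕ) → Fin (suc m) → Fin (suc m) → Set
PathAdj m i j = (toℕ i ≡ suc (toℕ j)) ⊎ (toℕ j ≡ suc (toℕ i))

record Path (G : Graph) (m : ℕ) : Set where
  field
    p        : Fin (suc m) → Vertex G
    distinct : Distinct {G} p
    induced  : ∀ i j → Adj G (p i) (p j) ⇔ PathAdj m i j

open Path public

-- the path lies in the hole H (vertex set contained in V(H)); since H is
-- induced in G, induced paths of G[V(H)] are exactly these.
PathInHole : ∀ {G k m} → Path G m → Hole G k → Set
PathInHole {m = m} P H = ∀ (i : Fin (suc m)) → ∃ λ t → h H t ≡ p P i

record Sector (G : Graph) {k : ℕ} (H : Hole G k) (x : Vertex G) (m : ℕ) : Set where
  field
    path     : Path G m
    inH      : PathInHole path H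
    nonzero  : 1 ≤ m
    endsAdj  : ∀ (i : Fin (suc m)) → (toℕ i ≡ 0 ⊎ toℕ i ≡ m) → Adj G x (p path i)
    interior : ∀ (i : Fin (suc m)) → ¬ (toℕ i ≡ 0) → ¬ (toℕ i ≡ m) → ¬ Adj G x (p path i)

-- A 2-sector a b c of x in H extends along H to an induced path p₀ a b c p₄,
-- which is still induced because H has length at least 6.  Triangle-freeness
-- keeps x away from p₀ and p₄, and a neighbour y of x two levels below H sees
-- no vertex of H.  So the 4-cycle x a b c with pendant vertices p₀, y, p₄ is a
-- 4-sunspot.  A 1-sector is a triangle with x.
module Submission where

open import Defs renaming (sym to adj-sym)
open import Data.Nat using (ℕ; suc; pred; _≤_; _<_; _∸_; _+_; _%_; z≤n; s≤s; NonZero; >-nonZero)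
open import Data.Nat.Properties
open import Data.Nat.DivMod
  using (_mod_; %-distribˡ-+; n%n≡0; m%n%n≡m%n; m<n⇒m%n≡m; m≤n⇒[n∸m]%m≡n%m; [m+n]%n≡m%n; m%n<n)
open import Data.Fin as Fin using (Fin; toℕ; fromℕ<; inject₁; #_)
open import Data.Fin.Properties using (toℕ-injective; toℕ-fromℕ<; toℕ-inject₁; toℕ<n; all?)
open import Data.Fin.Subset using (_∈_)
open import Data.Vec using (_∷_; []; lookup)
open import Data.Bool using (Bool; true; false; T)
open import Data.Bool.Properties using () renaming (_≟_ to _≟ᵇ_)
open import Data.Product using (∃; _×_; _,_; proj₁; proj₂)
open import Data.Sum as Sum using (_⊎_; inj₁; inj₂)
open import Data.Empty using (⊥)
open import Data.Unit using (tt)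
open import Function using (_∘_)
open import Function.Bundles using (_⇔_; mk⇔; Equivalence)
open import Function.Properties.Equivalence using () renaming (trans to ⇔-trans)
open import Relation.Nullary using (¬_; Dec; yes; no; contradiction)
open import Relation.Nullary.Decidable using (isYes; _⊎-dec_; toWitness; fromWitness)
open import Relation.Binary.PropositionalEquality
  using (_≡_; _≢_; refl; sym; trans; cong; subst; subst₂; module ≡-Reasoning)

open ≡-Reasoning
open Equivalence using (to; from)

[1+m%n]%n≡[1+m]%n : ∀ m n .{{_ : NonZero n}} → suc (m % n) % n ≡ suc m % n
[1+m%n]%n≡[1+m]%n m n = begin
  (1 + m % n) % n          ≡⟨ %-distribˡ-+ 1 (m % n) n ⟩
  (1 % n + m % n % n) % n  ≡⟨ cong (λ z → (1 % n + z) % n) (m%n%n≡m%n m n) ⟩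
  (1 % n + m % n) % n      ≡⟨ %-distribˡ-+ 1 m n ⟨
  (1 + m) % n              ∎

[m+n]%d≡m⇒n≡0 : ∀ {m n d} .{{_ : NonZero d}} → m < d → n < d → (m + n) % d ≡ m → n ≡ 0
[m+n]%d≡m⇒n≡0 {m} {n} {d} m<d n<d eq with m + n <? d
... | yes m+n<d = m+n≡m⇒n≡0 (trans (sym (m<n⇒m%n≡m m+n<d)) eq)
  where
  m+n≡m⇒n≡0 : m + n ≡ m → n ≡ 0
  m+n≡m⇒n≡0 e = +-cancelˡ-≡ m n 0 (trans e (sym (+-identityʳ m)))
... | no m+n≮d = contradiction n≡d (<⇒≢ n<d)
  where
  d≤m+n : d ≤ m + n
  d≤m+n = ≮⇒≥ m+n≮d
  m+n∸d<d : m + n ∸ d < d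
  m+n∸d<d = ≤-<-trans (subst (m + n ∸ d ≤_) (m+n∸n≡m m n) (∸-monoʳ-≤ (m + n) (<⇒≤ n<d))) m<d
  wrapped : m + n ∸ d ≡ m
  wrapped = begin
    m + n ∸ d        ≡⟨ m<n⇒m%n≡m m+n∸d<d ⟨
    (m + n ∸ d) % d  ≡⟨ m≤n⇒[n∸m]%m≡n%m d≤m+n ⟩
    (m + n) % d      ≡⟨ eq ⟩
    m                ∎
  n≡d : n ≡ d
  n≡d = +-cancelˡ-≡ m n d (begin
    m + n            ≡⟨ m∸n+n≡m d≤m+n ⟨
    m + n ∸ d + d    ≡⟨ cong (_+ d) wrapped ⟩
    m + d            ∎)

[m+n]%d≡[m+o]%d⇒n≡o : ∀ m {n o d} .{{_ : NonZero d}} → n < d → o < d →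
                      (m + n) % d ≡ (m + o) % d → n ≡ o
[m+n]%d≡[m+o]%d⇒n≡o m {n} {o} {d} n<d o<d eq =
  Sum.[ (λ n≤o → ordered n≤o o<d eq) , (λ o≤n → sym (ordered o≤n n<d (sym eq))) ]′ (≤-total n o)
  where
  ordered : ∀ {n o} → n ≤ o → o < d → (m + n) % d ≡ (m + o) % d → n ≡ o
  ordered {n} {o} n≤o o<d eq = ≤-antisym n≤o (m∸n≡0⇒m≤n o∸n≡0)
    where
    r = (m + n) % d
    o∸n<d : o ∸ n < d
    o∸n<d = ≤-<-trans (m∸n≤m o n) o<d
    wraps : (r + (o ∸ n)) % d ≡ r
    wraps = begin
      (r + (o ∸ n)) % d          ≡⟨ cong (λ z → (r + z) % d) (m<n⇒m%n≡m o∸n<d) ⟨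
      (r + (o ∸ n) % d) % d      ≡⟨ %-distribˡ-+ (m + n) (o ∸ n) d ⟨
      (m + n + (o ∸ n)) % d      ≡⟨ cong (_% d) (+-assoc m n (o ∸ n)) ⟩
      (m + (n + (o ∸ n))) % d    ≡⟨ cong (λ z → (m + z) % d) (m+[n∸m]≡n n≤o) ⟩
      (m + o) % d                ≡⟨ eq ⟨
      r                          ∎
    o∸n≡0 : o ∸ n ≡ 0
    o∸n≡0 = [m+n]%d≡m⇒n≡0 (m%n<n (m + n) d) o∸n<d wraps

module Cycle {k : ℕ} .{{_ : NonZero k}} where

  Next : Fin k → Fin k → Set
  Next u v = suc (toℕ u) % k ≡ toℕ v

  next-injective : ∀ {u v w} → Next u w → Next v w → u ≡ v
  next-injective {u} {v} uw vw =
    toℕ-injective ([m+n]%d≡[m+o]%d⇒n≡o 1 (toℕ<n u) (toℕ<n v) (trans uw (sym vw)))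

  next-functional : ∀ {u v w} → Next u v → Next u w → v ≡ w
  next-functional uv uw = toℕ-injective (trans (sym uv) uw)

  cycAdj-sym : ∀ {u v} → CycAdj k u v → CycAdj k v u
  cycAdj-sym (inj₁ e)               = inj₂ (inj₁ e)
  cycAdj-sym (inj₂ (inj₁ e))        = inj₁ e
  cycAdj-sym (inj₂ (inj₂ (inj₁ e))) = inj₂ (inj₂ (inj₂ e))
  cycAdj-sym (inj₂ (inj₂ (inj₂ e))) = inj₂ (inj₂ (inj₁ e))

  next⇒cycAdj : ∀ {u v} → Next u v → CycAdj k u v
  next⇒cycAdj {u} {v} uv with m≤n⇒m<n∨m≡n (toℕ<n u)
  ... | inj₁ 1+u<k = inj₂ (inj₁ (trans (sym uv) (m<n⇒m%n≡m 1+u<k)))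
  ... | inj₂ 1+u≡k = inj₂ (inj₂ (inj₂ (trans (sym uv) (trans (cong (_% k) 1+u≡k) (n%n≡0 k)) , 1+u≡k)))

  cycAdj⇒next : ∀ {u v} → CycAdj k u v → Next u v ⊎ Next v u
  cycAdj⇒next {u} {v} (inj₁ u≡1+v) =
    inj₂ (trans (m<n⇒m%n≡m (subst (_< k) u≡1+v (toℕ<n u))) (sym u≡1+v))
  cycAdj⇒next {u} {v} (inj₂ (inj₁ v≡1+u)) =
    inj₁ (trans (m<n⇒m%n≡m (subst (_< k) v≡1+u (toℕ<n v))) (sym v≡1+u))
  cycAdj⇒next (inj₂ (inj₂ (inj₁ (u≡0 , 1+v≡k)))) =
    inj₂ (trans (cong (_% k) 1+v≡k) (trans (n%n≡0 k) (sym u≡0)))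
  cycAdj⇒next (inj₂ (inj₂ (inj₂ (v≡0 , 1+u≡k)))) =
    inj₁ (trans (cong (_% k) 1+u≡k) (trans (n%n≡0 k) (sym v≡0)))

  cycAdj⇔next : ∀ u v → CycAdj k u v ⇔ (Next u v ⊎ Next v u)
  cycAdj⇔next u v = mk⇔ cycAdj⇒next Sum.[ next⇒cycAdj , cycAdj-sym ∘ next⇒cycAdj ]′

  orientation : ∀ {u v w} → Next u v ⊎ Next v u → Next v w ⊎ Next w v → u ≢ w →
                (Next u v × Next v w) ⊎ (Next w v × Next v u)
  orientation (inj₁ uv) (inj₁ vw) _   = inj₁ (uv , vw)
  orientation (inj₂ vu) (inj₂ wv) _   = inj₂ (wv , vu)
  orientation (inj₁ uv) (inj₂ wv) u≢w = contradiction (next-injective uv wv) u≢w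
  orientation (inj₂ vu) (inj₁ vw) u≢w = contradiction (next-functional vu vw) u≢w

  toℕ-mod : ∀ a → toℕ (a mod k) ≡ a % k
  toℕ-mod a = toℕ-fromℕ< (m%n<n a k)

  mod-next : ∀ {a u v} → a mod k ≡ u → Next u v → suc a mod k ≡ v
  mod-next {a} {u} {v} a≡u uv = toℕ-injective (begin
    toℕ (suc a mod k)         ≡⟨ toℕ-mod (suc a) ⟩
    suc a % k                 ≡⟨ [1+m%n]%n≡[1+m]%n a k ⟨
    suc (a % k) % k           ≡⟨ cong (λ z → suc z % k) (trans (sym (toℕ-mod a)) (cong toℕ a≡u)) ⟩
    suc (toℕ u) % k           ≡⟨ uv ⟩
    toℕ v                     ∎)

  next-mod⇔ : ∀ a b → Next (a mod k) (b mod k) ⇔ (suc a % k ≡ b % k)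
  next-mod⇔ a b = mk⇔ (λ e → trans (sym lhs) (trans e (toℕ-mod b)))
                      (λ e → trans lhs (trans e (sym (toℕ-mod b))))
    where
    lhs : suc (toℕ (a mod k)) % k ≡ suc a % k
    lhs = trans (cong (λ z → suc z % k) (toℕ-mod a)) ([1+m%n]%n≡[1+m]%n a k)

  predecessor-mod : ∀ u → suc (toℕ u + pred k) mod k ≡ u
  predecessor-mod u = toℕ-injective (begin
    toℕ (suc (toℕ u + pred k) mod k)  ≡⟨ toℕ-mod (suc (toℕ u + pred k)) ⟩
    suc (toℕ u + pred k) % k          ≡⟨ cong (_% k) (+-suc (toℕ u) (pred k)) ⟨
    (toℕ u + suc (pred k)) % k        ≡⟨ cong (λ z → (toℕ u + z) % k) (suc-pred k) ⟩
    (toℕ u + k) % k                   ≡⟨ [m+n]%n≡m%n (toℕ u) k ⟩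
    toℕ u % k                         ≡⟨ m<n⇒m%n≡m (toℕ<n u) ⟩
    toℕ u                             ∎)

module HoleWalk {G : Graph} {k : ℕ} (H : Hole G k) .{{_ : NonZero k}} where
  open Cycle

  at : ℕ → Vertex G
  at a = h H (a mod k)

  hole-adj : ∀ u v → Adj G (h H u) (h H v) ⇔ (Next u v ⊎ Next v u)
  hole-adj u v = ⇔-trans (induced H u v) (cycAdj⇔next u v)

  at-adj : ∀ a b → Adj G (at a) (at b) ⇔ (suc a % k ≡ b % k ⊎ suc b % k ≡ a % k)
  at-adj a b = ⇔-trans (hole-adj (a mod k) (b mod k))
    (mk⇔ (Sum.map (to (next-mod⇔ a b)) (to (next-mod⇔ b a)))
         (Sum.map (from (next-mod⇔ a b)) (from (next-mod⇔ b a))))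

  at-injective : ∀ {a b} → at a ≡ at b → a % k ≡ b % k
  at-injective {a} {b} e = trans (sym (toℕ-mod a)) (trans (cong toℕ (distinct H _ _ e)) (toℕ-mod b))

  -- m + 2 ≤ k keeps the two ends of the segment from being adjacent around H.
  segment : ∀ {m} → suc (suc m) ≤ k → ℕ → Path G m
  segment {m} m+2≤k s = record
    { p        = λ i → at (toℕ i + s)
    ; distinct = λ i j e → toℕ-injective (cancel (index<k i) (index<k j) (at-injective e))
    ; induced  = λ i j → ⇔-trans (at-adj (toℕ i + s) (toℕ j + s))
                   (mk⇔ (Sum.swap ∘ Sum.map (sym ∘ step i j) (sym ∘ step j i))
                        (Sum.map (step⁻¹ i j ∘ sym) (step⁻¹ j i ∘ sym) ∘ Sum.swap))
    }
    where
    index<k : (i : Fin (suc m)) → toℕ i < k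
    index<k i = <-≤-trans (toℕ<n i) (≤-trans (n≤1+n (suc m)) m+2≤k)

    cancel : ∀ {a b} → a < k → b < k → (a + s) % k ≡ (b + s) % k → a ≡ b
    cancel {a} {b} a<k b<k e =
      [m+n]%d≡[m+o]%d⇒n≡o s a<k b<k (subst₂ (λ x y → x % k ≡ y % k) (+-comm a s) (+-comm b s) e)

    step : ∀ i j → (suc (toℕ i) + s) % k ≡ (toℕ j + s) % k → suc (toℕ i) ≡ toℕ j
    step i j = cancel (≤-trans (s≤s (toℕ<n i)) m+2≤k) (index<k j)

    step⁻¹ : ∀ i j → suc (toℕ i) ≡ toℕ j → (suc (toℕ i) + s) % k ≡ (toℕ j + s) % k
    step⁻¹ i j e = cong (λ z → (z + s) % k) e

-- The path p₀ … p₄ of a sector configuration, x as hub and y as tip.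
data Spot : Set where
  on  : Fin 5 → Spot
  hub : Spot
  tip : Spot

pathAdj? : ∀ {m} (i j : Fin (suc m)) → Dec (PathAdj m i j)
pathAdj? i j = (toℕ i ≟ suc (toℕ j)) ⊎-dec (toℕ j ≟ suc (toℕ i))

hubSees : Fin 5 → Bool
hubSees (Fin.suc Fin.zero)                     = true
hubSees (Fin.suc (Fin.suc (Fin.suc Fin.zero))) = true
hubSees _                                      = false

spotEdge : Spot → Spot → Bool
spotEdge (on i) (on j) = isYes (pathAdj? i j)
spotEdge hub    (on i) = hubSees i
spotEdge (on i) hub    = hubSees i
spotEdge hub    tip    = true
spotEdge tip    hub    = true
spotEdge _      _      = false

-- The 4-sunspot (x₁, x₂, x₃, x₄; y₁, y₂, y₃) = (p₁, hub, p₃, p₂; p₀, tip, p₄).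
spot : Fin 7 → Spot
spot a = lookup (on (# 1) ∷ hub ∷ on (# 3) ∷ on (# 2) ∷ on (# 0) ∷ tip ∷ on (# 4) ∷ []) a

label : Spot → Fin 7
label (on i) = lookup (# 4 ∷ # 0 ∷ # 3 ∷ # 2 ∷ # 6 ∷ []) i
label hub    = # 1
label tip    = # 5

label∘spot : ∀ a → label (spot a) ≡ a
label∘spot = toWitness {a? = all? λ a → label (spot a) Fin.≟ a} _

sunEdge≡spotEdge : ∀ a b → sunEdge a b ≡ spotEdge (spot a) (spot b)
sunEdge≡spotEdge = toWitness {a? = all? λ a → all? λ b → sunEdge a b ≟ᵇ spotEdge (spot a) (spot b)} _

module P₅Sunspot {G : Graph} (triangleFree : TriangleFree G) (P : Path G 4) {x y : Vertex G}
  (x∉P : ∀ i → x ≢ p P i)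
  (x~p₁ : Adj G x (p P (# 1))) (x≁p₂ : ¬ Adj G x (p P (# 2))) (x~p₃ : Adj G x (p P (# 3)))
  (x~y : Adj G x y) (y≁P : ∀ i → ¬ Adj G y (p P i)) where

  vertex : Spot → Vertex G
  vertex (on i) = p P i
  vertex hub    = x
  vertex tip    = y

  edge : ∀ {u v} → Adj G u v → Adj G u v ⇔ T true
  edge uv = mk⇔ (λ _ → tt) (λ _ → uv)

  nonedge : ∀ {u v} → ¬ Adj G u v → Adj G u v ⇔ T false
  nonedge u≁v = mk⇔ u≁v λ ()

  adj-comm : ∀ {u v} → Adj G u v ⇔ Adj G v u
  adj-comm = mk⇔ (adj-sym G) (adj-sym G)

  consecutive : ∀ (i : Fin 4) → Adj G (p P (inject₁ i)) (p P (Fin.suc i))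
  consecutive i = from (induced P (inject₁ i) (Fin.suc i)) (inj₂ (cong suc (sym (toℕ-inject₁ i))))

  hub-adj : ∀ i → Adj G x (p P i) ⇔ T (hubSees i)
  hub-adj Fin.zero = nonedge λ x~p₀ → triangleFree x _ _ x~p₀ (consecutive (# 0)) x~p₁
  hub-adj (Fin.suc Fin.zero) = edge x~p₁
  hub-adj (Fin.suc (Fin.suc Fin.zero)) = nonedge x≁p₂
  hub-adj (Fin.suc (Fin.suc (Fin.suc Fin.zero))) = edge x~p₃
  hub-adj (Fin.suc (Fin.suc (Fin.suc (Fin.suc Fin.zero)))) =
    nonedge λ x~p₄ → triangleFree x _ _ x~p₃ (consecutive (# 3)) x~p₄

  vertex-adj : ∀ u v → Adj G (vertex u) (vertex v) ⇔ T (spotEdge u v)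
  vertex-adj (on i) (on j) = ⇔-trans (induced P i j) (mk⇔ fromWitness toWitness)
  vertex-adj hub    (on i) = hub-adj i
  vertex-adj (on i) hub    = ⇔-trans adj-comm (hub-adj i)
  vertex-adj tip    (on i) = nonedge (y≁P i)
  vertex-adj (on i) tip    = nonedge (y≁P i ∘ adj-sym G)
  vertex-adj hub    tip    = edge x~y
  vertex-adj tip    hub    = edge (adj-sym G x~y)
  vertex-adj hub    hub    = nonedge (irrefl G x)
  vertex-adj tip    tip    = nonedge (irrefl G y)

  y∉P : ∀ i → y ≢ p P i
  y∉P Fin.zero    y≡p₀ = y≁P (# 1) (subst (λ z → Adj G z _) (sym y≡p₀) (consecutive (# 0)))
  y∉P (Fin.suc i) y≡p  = y≁P (inject₁ i) (subst (λ z → Adj G z _) (sym y≡p) (adj-sym G (consecutive i)))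

  vertex-injective : ∀ {u v} → vertex u ≡ vertex v → u ≡ v
  vertex-injective {on i} {on j} e = cong on (distinct P i j e)
  vertex-injective {on i} {hub}  e = contradiction (sym e) (x∉P i)
  vertex-injective {hub}  {on j} e = contradiction e (x∉P j)
  vertex-injective {on i} {tip}  e = contradiction (sym e) (y∉P i)
  vertex-injective {tip}  {on j} e = contradiction e (y∉P j)
  vertex-injective {hub}  {tip}  e = contradiction (subst (Adj G x) (sym e) x~y) (irrefl G x)
  vertex-injective {tip}  {hub}  e = contradiction (subst (Adj G x) e x~y) (irrefl G x)
  vertex-injective {hub}  {hub}  _ = refl
  vertex-injective {tip}  {tip}  _ = refl

  sunspot : Sunspot4 G
  sunspot = vertex ∘ spot , spot-distinct , spot-adj
    where
    spot-distinct : Distinct {G} (vertex ∘ spot)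
    spot-distinct a b e = begin
      a              ≡⟨ label∘spot a ⟨
      label (spot a) ≡⟨ cong label (vertex-injective {spot a} {spot b} e) ⟩
      label (spot b) ≡⟨ label∘spot b ⟩
      b              ∎

    spot-adj : ∀ a b → Adj G (vertex (spot a)) (vertex (spot b)) ⇔ T (sunEdge a b)
    spot-adj a b = subst (λ e → Adj G (vertex (spot a)) (vertex (spot b)) ⇔ T e)
                         (sym (sunEdge≡spotEdge a b)) (vertex-adj (spot a) (spot b))

sector₁⇒triangle : ∀ {G k x} {H : Hole G k} → TriangleFree G → ¬ Sector G H x 1
sector₁⇒triangle {x = x} tf S =
  tf x (p Q (# 0)) (p Q (# 1)) (Sector.endsAdj S (# 0) (inj₁ refl))
     (from (induced Q (# 0) (# 1)) (inj₂ refl)) (Sector.endsAdj S (# 1) (inj₂ refl))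
  where
  Q = Sector.path S

module HoleSector {G : Graph} {k : ℕ} (H : Hole G k) .{{_ : NonZero k}}
                  (6≤k : 6 ≤ k) (triangleFree : TriangleFree G) where
  open Cycle
  open HoleWalk H

  consecutive-sector⇒sunspot : ∀ {x y u v w} → Next u v → Next v w →
    Adj G x (h H u) → ¬ Adj G x (h H v) → Adj G x (h H w) → (∀ t → x ≢ h H t) →
    Adj G x y → (∀ t → ¬ Adj G y (h H t)) → Sunspot4 G
  consecutive-sector⇒sunspot {x} {u = u} uv vw x~u x≁v x~w x∉H x~y y≁H =
    P₅Sunspot.sunspot triangleFree (segment 6≤k s) (λ _ → x∉H _)
      (subst (Adj G x) (cong (h H) (sym e₁)) x~u)
      (x≁v ∘ subst (Adj G x) (cong (h H) e₂))
      (subst (Adj G x) (cong (h H) (sym e₃)) x~w)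
      x~y (λ _ → y≁H _)
    where
    s : ℕ
    s = toℕ u + pred k
    e₁ = predecessor-mod u
    e₂ = mod-next e₁ uv
    e₃ = mod-next e₂ vw

  sector₂⇒sunspot : ∀ {x y} → Sector G H x 2 → (∀ t → x ≢ h H t) →
    Adj G x y → (∀ t → ¬ Adj G y (h H t)) → Sunspot4 G
  sector₂⇒sunspot {x} S x∉H x~y y≁H =
    Sum.[ (λ (uv , vw) → consecutive-sector⇒sunspot uv vw end₀ unseen end₂ x∉H x~y y≁H)
        , (λ (wv , vu) → consecutive-sector⇒sunspot wv vu end₂ unseen end₀ x∉H x~y y≁H)
        ]′ (orientation (adjacent (# 0)) (adjacent (# 1)) t₀≢t₂)
    where
    Q = Sector.path S

    t : Fin 3 → Fin k
    t i = proj₁ (Sector.inH S i)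

    t≡ : ∀ i → h H (t i) ≡ p Q i
    t≡ i = proj₂ (Sector.inH S i)

    adjacent : (i : Fin 2) → Next (t (inject₁ i)) (t (Fin.suc i)) ⊎ Next (t (Fin.suc i)) (t (inject₁ i))
    adjacent i = to (hole-adj _ _) (subst₂ (Adj G) (sym (t≡ _)) (sym (t≡ _))
      (from (induced Q (inject₁ i) (Fin.suc i)) (inj₂ (cong suc (sym (toℕ-inject₁ i))))))

    t₀≢t₂ : t (# 0) ≢ t (# 2)
    t₀≢t₂ e with distinct Q (# 0) (# 2) (trans (sym (t≡ _)) (trans (cong (h H) e) (t≡ _)))
    ... | ()

    end₀ : Adj G x (h H (t (# 0)))
    end₀ = subst (Adj G x) (sym (t≡ _)) (Sector.endsAdj S (# 0) (inj₁ refl))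

    end₂ : Adj G x (h H (t (# 2)))
    end₂ = subst (Adj G x) (sym (t≡ _)) (Sector.endsAdj S (# 2) (inj₂ refl))

    unseen : ¬ Adj G x (h H (t (# 1)))
    unseen = Sector.interior S (# 1) (λ ()) (λ ()) ∘ subst (Adj G x) (t≡ _)

module Levels {G : Graph} {r : ℕ} (Lv : Leveling G r) where

  InLevel : ℕ → Vertex G → Set
  InLevel ℓ v = ∀ (i : Fin (suc r)) → toℕ i ≡ ℓ → v ∈ L Lv i

  level : ∀ {ℓ} → ℓ ≤ r → Fin (suc r)
  level ℓ≤r = fromℕ< (s≤s ℓ≤r)

  toℕ-level : ∀ {ℓ} (ℓ≤r : ℓ ≤ r) → toℕ (level ℓ≤r) ≡ ℓ
  toℕ-level ℓ≤r = toℕ-fromℕ< (s≤s ℓ≤r)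

  level-injective : ∀ {ℓ ℓ′} (ℓ≤r : ℓ ≤ r) (ℓ′≤r : ℓ′ ≤ r) → level ℓ≤r ≡ level ℓ′≤r → ℓ ≡ ℓ′
  level-injective ℓ≤r ℓ′≤r e = trans (sym (toℕ-level ℓ≤r)) (trans (cong toℕ e) (toℕ-level ℓ′≤r))

  inLevel-distinct : ∀ {ℓ ℓ′ u v} → ℓ ≤ r → ℓ′ ≤ r → ℓ ≢ ℓ′ → InLevel ℓ u → InLevel ℓ′ v → u ≢ v
  inLevel-distinct ℓ≤r ℓ′≤r ℓ≢ℓ′ u∈ v∈ refl =
    disjoint Lv (level ℓ≤r) (level ℓ′≤r) (ℓ≢ℓ′ ∘ level-injective ℓ≤r ℓ′≤r) _
      (u∈ _ (toℕ-level ℓ≤r)) (v∈ _ (toℕ-level ℓ′≤r))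

  inLevel-nonadjacent : ∀ {ℓ ℓ′ u v} → suc (suc ℓ) ≤ ℓ′ → ℓ′ ≤ r →
                        InLevel ℓ u → InLevel ℓ′ v → ¬ Adj G u v
  inLevel-nonadjacent {ℓ} {ℓ′} ℓ+2≤ℓ′ ℓ′≤r u∈ v∈ uv =
    Sum.[ (λ ℓ≡1+ℓ′ → <-asym ℓ<ℓ′ (≤-reflexive (sym (in-ℕ ℓ≤r ℓ′≤r ℓ≡1+ℓ′))))
        , (λ ℓ′≡1+ℓ → 1+n≰n (subst (suc (suc ℓ) ≤_) (in-ℕ ℓ′≤r ℓ≤r ℓ′≡1+ℓ) ℓ+2≤ℓ′))
        ]′ (edges Lv (level ℓ≤r) (level ℓ′≤r) (<⇒≢ ℓ<ℓ′ ∘ level-injective ℓ≤r ℓ′≤r) _ _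
                  (u∈ _ (toℕ-level ℓ≤r)) (v∈ _ (toℕ-level ℓ′≤r)) uv)
    where
    ℓ<ℓ′ : ℓ < ℓ′
    ℓ<ℓ′ = ≤-trans (n≤1+n (suc ℓ)) ℓ+2≤ℓ′
    ℓ≤r : ℓ ≤ r
    ℓ≤r = ≤-trans (<⇒≤ ℓ<ℓ′) ℓ′≤r
    in-ℕ : ∀ {a b} (a≤r : a ≤ r) (b≤r : b ≤ r) → toℕ (level a≤r) ≡ suc (toℕ (level b≤r)) → a ≡ suc b
    in-ℕ a≤r b≤r = subst₂ (λ a b → a ≡ suc b) (toℕ-level a≤r) (toℕ-level b≤r)

  inLevel-down : ∀ {ℓ v} → suc ℓ ≤ r → InLevel (suc ℓ) v → ∃ λ u → InLevel ℓ u × Adj G v u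
  inLevel-down {ℓ} {v} ℓ<r v∈ = u , u∈ , proj₂ (proj₂ below)
    where
    i : Fin r
    i = fromℕ< ℓ<r
    below = down Lv i v (v∈ (Fin.suc i) (cong suc (toℕ-fromℕ< ℓ<r)))
    u = proj₁ below
    u∈ : InLevel ℓ u
    u∈ j e = subst (λ j → u ∈ L Lv j)
      (toℕ-injective (trans (toℕ-inject₁ i) (trans (toℕ-fromℕ< ℓ<r) (sym e)))) (proj₁ (proj₂ below))

lemma2p4 : (G : Graph) (r : ℕ) → 2 ≤ r → TriangleFree G → SunspotFree4 G →
    (Lv : Leveling G r) → (k : ℕ) → (H : Hole G k) → 6 ≤ k →
    (∀ (i : Fin (suc r)) → toℕ i ≡ r → ∀ t → h H t ∈ L Lv i) →
    (x : Vertex G) → (∀ (j : Fin (suc r)) → toℕ j ≡ r ∸ 1 → x ∈ L Lv j) →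
    (m : ℕ) → m ≤ 2 → Sector G H x m → ⊥
lemma2p4 _ _ _ _ _ _ _ _ _ _ _ _ 0 _ S = contradiction (Sector.nonzero S) λ ()
lemma2p4 _ _ _ triangleFree _ _ _ _ _ _ _ _ 1 _ S = sector₁⇒triangle triangleFree S
lemma2p4 _ 0 () _ _ _ _ _ _ _ _ _ 2 _ _
lemma2p4 _ 1 (s≤s ()) _ _ _ _ _ _ _ _ _ 2 _ _
lemma2p4 G (suc (suc ℓ)) _ triangleFree sunspotFree Lv k H 6≤k H∈L x x∈L 2 _ S
  with Levels.inLevel-down Lv (n≤1+n (suc ℓ)) x∈L
... | y , y∈L , x~y =
  sunspotFree (HoleSector.sector₂⇒sunspot H {{>-nonZero (≤-trans (s≤s z≤n) 6≤k)}} 6≤k triangleFree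
                 S x∉H x~y y≁H)
  where
  open Levels Lv
  hole-level : ∀ t → InLevel (suc (suc ℓ)) (h H t)
  hole-level t i e = H∈L i e t
  x∉H : ∀ t → x ≢ h H t
  x∉H t = inLevel-distinct (n≤1+n (suc ℓ)) ≤-refl (<⇒≢ (n<1+n (suc ℓ))) x∈L (hole-level t)
  y≁H : ∀ t → ¬ Adj G y (h H t)
  y≁H t = inLevel-nonadjacent ≤-refl ≤-refl y∈L (hole-level t)
lemma2p4 _ _ _ _ _ _ _ _ _ _ _ _ (suc (suc (suc _))) (s≤s (s≤s ())) _
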